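{- Let $n\ge5$ be odd, $T=\langle n,3n-2,3n-1\rangle$, $\mathrm F(T)=\max(\mathbb Z\setminus T)$ and $S=T\cup\{\mathrm F(T)\}$, and let $i$ be an integer with $2\le i\le\frac{n-1}{2}$. Let $\mathcal M_i=\{s\in M_i : \mathrm{nf}(s)\text{ is minimal in }\mathrm{nf}(M_i)\}$. Then $\mathcal M_i$ has exactly two elements, namely $\mathcal M_i=\left\{\mathbf s_i=\frac{3n-5}{2}n+(i-2)(3n-2)+(3n-1),\ \ \mathbf s_i'=3(i-1)n+(i-1)(3n-2)\right\}$.
   Context: For $m\in S\setminus\{0\}$, $\mathrm{Ap}(S,m)=\{s\in S: s-m\notin S\}$. For $s\in\mathrm{Ap}(S,\mathrm F(T))$ (such $s$ lie in $T$), $\mathsf Z(s)=\{(x,y,z)\in\mathbb N^3: xn+y(3n-2)+z(3n-1)=s\}$, and $\mathrm{nf}(s)$ is the unique element $(x,y,z)\in\mathsf Z(s)$ with $z<2$, $y<\frac{n+1}{2}$, $x<\frac{3n-1}{2}$. $M_i=\{s\in\mathrm{Ap}(S,\mathrm F(T)): \#\mathsf Z(s)=i\}$, $\mathrm{nf}(M_i)=\{\mathrm{nf}(s):s\in M_i\}$, and minimality is with respect to the componentwise partial order on $\mathbb N^3$. -}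

module Defs where

open import Data.Nat using (ℕ; _+_; _*_; _∸_; _≤_; _<_)
open import Data.Nat.DivMod using (_/_)
open import Data.Product using (Σ; _×_; ∃; ∃-syntax; _,_)
open import Data.Sum using (_⊎_)
open import Data.Fin using (Fin)
open import Function.Bundles using (_↔_)
open import Relation.Binary.PropositionalEquality using (_≡_)
open import Relation.Nullary using (¬_)

ℕ³ : Set
ℕ³ = ℕ × ℕ × ℕ

_≤₃_ : ℕ³ → ℕ³ → Set
(x , y , z) ≤₃ (x' , y' , z') = x ≤ x' × y ≤ y' × z ≤ z'

val : ℕ → ℕ³ → ℕ
val n (x , y , z) = x * n + y * (3 * n ∸ 2) + z * (3 * n ∸ 1)

Z : ℕ → ℕ → Set
Z n s = Σ ℕ³ λ v → val n v ≡ s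

InT : ℕ → ℕ → Set
InT n s = ∃[ v ] val n v ≡ s

-- f is the Frobenius number of T: max(ℤ \ T)  (negative integers are never in T,
-- and 1 ∉ T for n ≥ 5, so the maximum is a natural number)
IsFrobenius : ℕ → ℕ → Set
IsFrobenius n f = ¬ InT n f × (∀ m → f < m → InT n m)

InS : ℕ → ℕ → ℕ → Set
InS n f s = InT n s ⊎ s ≡ f

-- Ap(S, f) = { s ∈ S : s - f ∉ S }  (s - f taken in ℤ; it lies in S only if f ≤ s)
InAp : ℕ → ℕ → ℕ → Set
InAp n f s = InS n f s × ¬ (f ≤ s × InS n f (s ∸ f))

HasCard : ℕ → ℕ → ℕ → Set
HasCard n s i = Fin i ↔ Z n s

InM : ℕ → ℕ → ℕ → ℕ → Set
InM n f i s = InAp n f s × HasCard n s i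

IsNf : ℕ → ℕ → ℕ³ → Set
IsNf n s (x , y , z) =
  val n (x , y , z) ≡ s × z < 2 × y < (n + 1) / 2 × x < (3 * n ∸ 1) / 2

InCalM : ℕ → ℕ → ℕ → ℕ → Set
InCalM n f i s =
  InM n f i s ×
  (∃[ v ] (IsNf n s v ×
    (∀ s' w → InM n f i s' → IsNf n s' w → w ≤₃ v → w ≡ v)))

sᵢ : ℕ → ℕ → ℕ
sᵢ n i = ((3 * n ∸ 5) / 2) * n + (i ∸ 2) * (3 * n ∸ 2) + (3 * n ∸ 1)

sᵢ' : ℕ → ℕ → ℕ
sᵢ' n i = 3 * (i ∸ 1) * n + (i ∸ 1) * (3 * n ∸ 2)

-- Write n = 5 + 2k and i = 2 + j. A triple v = (x, y, z) has value level · n − defect, where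
-- level = x + 3y + 3z and defect = 2y + z, and 2 · level − 3 · defect = 2x + 3z. Comparing two
-- factorizations of one element modulo n shows that, when z ≤ 1, x ≤ 6 + 3k and the defect is
-- below n, every other factorization arises from t trades 3n + (3n − 2) = 2(3n − 1) or, if z = 1,
-- from one swap (5 + 3k)n + (3n − 1) = (3 + k)(3n − 2). The normal form of every element of
-- Ap(S, F(T)) satisfies these conditions: the one exception, (y, z) = (2 + k, 1), lies outside the
-- Apéry set. Indexing a trade by t and the swap by j, an element whose normal form dominates
-- neither nf(s'ᵢ) = (3(i − 1), i − 1, 0) nor nf(sᵢ) = ((3n − 5)/2, i − 2, 1) has at most i − 1
-- factorizations. Hence every element of nf(M_i) dominates one of these two, which lie in nf(M_i)
-- and are incomparable, so they are exactly its minimal elements.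

module Submission where

open import Defs
open import Data.Nat using (ℕ; zero; suc; _+_; _*_; _∸_; _≤_; _<_; _≤?_; z≤n; s≤s; s≤s⁻¹)
open import Data.Nat.Properties
open import Data.Nat.DivMod using (_/_; _%_; m≡m%n+[m/n]*n; m%n<n; m*n/n≡m)
open import Data.Nat.Tactic.RingSolver using (solve)
open import Data.Fin using (Fin; toℕ; fromℕ<) renaming (zero to fzero; suc to fsuc)
open import Data.Fin.Properties using (toℕ-fromℕ<; fromℕ<-toℕ; toℕ≤pred[n]; injective⇒≤)
open import Data.List using ([]; _∷_)
open import Data.Product using (_×_; _,_; proj₁; proj₂; ∃)
open import Data.Product.Properties using (Σ-≡,≡→≡)
open import Data.Sum using (_⊎_; inj₁; inj₂; [_,_]′)
open import Data.Empty using (⊥; ⊥-elim)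
open import Function using (_∋_; id)
open import Function.Bundles using (_⇔_; mk⇔; _↔_; mk↔ₛ′; Inverse)
open import Relation.Nullary using (¬_; Dec; yes; no; _×-dec_)
open import Relation.Binary using (tri<; tri≈; tri>)
open import Relation.Binary.PropositionalEquality

≡+suc⇒≢ : ∀ {a b} c → a ≡ b + suc c → a ≢ b
≡+suc⇒≢ {b = b} c a≡b+1+c a≡b = m+1+n≢m b (trans (sym a≡b+1+c) a≡b)

+≡⇒≤ : ∀ {a b} d → a + d ≡ b → a ≤ b
+≡⇒≤ {a} d eq = subst (a ≤_) eq (m≤m+n a d)

2*[m/2]+m%2≡m : ∀ m → 2 * (m / 2) + m % 2 ≡ m
2*[m/2]+m%2≡m m = trans (+-comm (2 * (m / 2)) (m % 2))
  (trans (cong (m % 2 +_) (*-comm 2 (m / 2))) (sym (m≡m%n+[m/n]*n m 2)))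

carry : ∀ n {P Q P′ Q′} → P * n + Q′ ≡ P′ * n + Q → Q < n →
        ∃ λ m → P′ ≡ P + m × Q′ ≡ Q + m * n
carry n {P} {Q} {P′} {Q′} eq Q<n with ≤-<-connex P P′
... | inj₁ P≤P′ with m≤n⇒∃[o]m+o≡n P≤P′
...   | m , refl = m , refl , +-cancelˡ-≡ (P * n) Q′ (Q + m * n) (begin
        P * n + Q′           ≡⟨ eq ⟩
        (P + m) * n + Q      ≡⟨ solve (P ∷ m ∷ n ∷ Q ∷ []) ⟩
        P * n + (Q + m * n)  ∎)
  where open ≡-Reasoning
carry n {P} {Q} {P′} {Q′} eq Q<n | inj₂ P′<P with m≤n⇒∃[o]m+o≡n P′<P
... | d , refl = ⊥-elim (<⇒≱ Q<n (subst (n ≤_) n+[dn+Q′]≡Q (m≤m+n n (d * n + Q′))))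
  where
  n+[dn+Q′]≡Q : n + (d * n + Q′) ≡ Q
  n+[dn+Q′]≡Q = +-cancelˡ-≡ (P′ * n) _ _ (trans
    (P′ * n + (n + (d * n + Q′)) ≡ (suc P′ + d) * n + Q′ ∋ solve (P′ ∷ d ∷ n ∷ Q′ ∷ [])) eq)

-- An odd n ≥ 5 is N k = 5 + 2k; then 3n − 2 = 13 + 6k and 3n − 1 = 14 + 6k, and valₖ is val
-- without truncated subtraction.
N : ℕ → ℕ
N k = 5 + 2 * k

valₖ : ℕ → ℕ³ → ℕ
valₖ k (x , y , z) = x * N k + y * (13 + 6 * k) + z * (14 + 6 * k)

3N∸2≡13+6k : ∀ k → 3 * N k ∸ 2 ≡ 13 + 6 * k
3N∸2≡13+6k k = cong (_∸ 2) (3 * (5 + 2 * k) ≡ 2 + (13 + 6 * k) ∋ solve (k ∷ []))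

3N∸1≡14+6k : ∀ k → 3 * N k ∸ 1 ≡ 14 + 6 * k
3N∸1≡14+6k k = cong (_∸ 1) (3 * (5 + 2 * k) ≡ 1 + (14 + 6 * k) ∋ solve (k ∷ []))

val≡valₖ : ∀ k v → val (N k) v ≡ valₖ k v
val≡valₖ k (x , y , z) = cong₂ (λ b c → x * N k + y * b + z * c) (3N∸2≡13+6k k) (3N∸1≡14+6k k)

[N∸1]/2≡2+k : ∀ k → (N k ∸ 1) / 2 ≡ 2 + k
[N∸1]/2≡2+k k = trans (cong (_/ 2) (4 + 2 * k ≡ (2 + k) * 2 ∋ solve (k ∷ []))) (m*n/n≡m (2 + k) 2)

[N+1]/2≡3+k : ∀ k → (N k + 1) / 2 ≡ 3 + k
[N+1]/2≡3+k k = trans (cong (_/ 2) (5 + 2 * k + 1 ≡ (3 + k) * 2 ∋ solve (k ∷ []))) (m*n/n≡m (3 + k) 2)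

[3N∸1]/2≡7+3k : ∀ k → (3 * N k ∸ 1) / 2 ≡ 7 + 3 * k
[3N∸1]/2≡7+3k k = trans (cong (λ a → (a ∸ 1) / 2) (3 * (5 + 2 * k) ≡ 1 + (7 + 3 * k) * 2 ∋ solve (k ∷ [])))
                        (m*n/n≡m (7 + 3 * k) 2)

[3N∸5]/2≡5+3k : ∀ k → (3 * N k ∸ 5) / 2 ≡ 5 + 3 * k
[3N∸5]/2≡5+3k k = trans (cong (λ a → (a ∸ 5) / 2) (3 * (5 + 2 * k) ≡ 5 + (5 + 3 * k) * 2 ∋ solve (k ∷ [])))
                        (m*n/n≡m (5 + 3 * k) 2)

odd≥5⇒≡N : ∀ n → 5 ≤ n → n % 2 ≡ 1 → ∃ λ k → n ≡ N k
odd≥5⇒≡N n 5≤n odd = n / 2 ∸ 2 , (begin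
  n                               ≡⟨ n≡1+[n/2]*2 ⟩
  1 + n / 2 * 2                   ≡⟨ cong (λ q → 1 + q * 2) (sym (m+[n∸m]≡n 2≤n/2)) ⟩
  1 + (2 + (n / 2 ∸ 2)) * 2       ≡⟨ expand (n / 2 ∸ 2) ⟩
  N (n / 2 ∸ 2)                   ∎)
  where
  open ≡-Reasoning
  n≡1+[n/2]*2 : n ≡ 1 + n / 2 * 2
  n≡1+[n/2]*2 = trans (m≡m%n+[m/n]*n n 2) (cong (_+ n / 2 * 2) odd)
  2≤n/2 : 2 ≤ n / 2
  2≤n/2 = *-cancelʳ-≤ 2 (n / 2) 2 (s≤s⁻¹ (subst (5 ≤_) n≡1+[n/2]*2 5≤n))
  expand : ∀ k → 1 + (2 + k) * 2 ≡ 5 + 2 * k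
  expand k = solve (k ∷ [])

-- Level and defect

level defect slack : ℕ³ → ℕ
level  (x , y , z) = x + 3 * y + 3 * z
defect (x , y , z) = 2 * y + z
slack  (x , y , z) = 2 * x + 3 * z

valₖ+defect≡level*N : ∀ k v → valₖ k v + defect v ≡ level v * N k
valₖ+defect≡level*N k (x , y , z) =
  x * (5 + 2 * k) + y * (13 + 6 * k) + z * (14 + 6 * k) + (2 * y + z) ≡ (x + 3 * y + 3 * z) * (5 + 2 * k)
  ∋ solve (k ∷ x ∷ y ∷ z ∷ [])

valₖ≡⇒carry : ∀ k {v v′} → valₖ k v′ ≡ valₖ k v → defect v < N k →
  ∃ λ m → level v′ ≡ level v + m × defect v′ ≡ defect v + m * N k
valₖ≡⇒carry k {v} {v′} eq d<N = carry (N k) (begin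
  level v * N k + defect v′              ≡⟨ cong (_+ defect v′) (sym (valₖ+defect≡level*N k v)) ⟩
  valₖ k v + defect v + defect v′        ≡⟨ cong (λ a → a + defect v + defect v′) (sym eq) ⟩
  valₖ k v′ + defect v + defect v′       ≡⟨ swap₂₃ (valₖ k v′) (defect v) (defect v′) ⟩
  valₖ k v′ + defect v′ + defect v       ≡⟨ cong (_+ defect v) (valₖ+defect≡level*N k v′) ⟩
  level v′ * N k + defect v              ∎) d<N
  where
  open ≡-Reasoning
  swap₂₃ : ∀ a b c → a + b + c ≡ a + c + b
  swap₂₃ a b c = solve (a ∷ b ∷ c ∷ [])

-- Read 2 · L + c = S + 3 · D as "slack = 2 · level − 3 · defect", the offsets c, c′ absorbing the
-- summand 2 of F(T): a carry by m lowers the slack by m(3n − 2).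
carry-slack : ∀ k m {L D S c L′ D′ S′ c′} →
  2 * L + c ≡ S + 3 * D → 2 * L′ + c′ ≡ S′ + 3 * D′ → L′ ≡ L + m → D′ ≡ D + m * N k →
  m * (13 + 6 * k) + S′ + c ≡ S + c′
carry-slack k m {L} {D} {S} {c} {L′} {D′} {S′} {c′} e e′ eL eD = +-cancelʳ-≡ (3 * D′ + 2 * L) _ _ (begin
  m * (13 + 6 * k) + S′ + c + (3 * D′ + 2 * L)           ≡⟨ regroup S′ D′ ⟩
  m * (13 + 6 * k) + (S′ + 3 * D′) + (2 * L + c)         ≡⟨ cong₂ (λ a b → m * (13 + 6 * k) + a + b) (sym e′) e ⟩
  m * (13 + 6 * k) + (2 * L′ + c′) + (S + 3 * D)
    ≡⟨ cong (λ l → m * (13 + 6 * k) + (2 * l + c′) + (S + 3 * D)) eL ⟩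
  m * (13 + 6 * k) + (2 * (L + m) + c′) + (S + 3 * D)    ≡⟨ collect ⟩
  S + c′ + (3 * (D + m * (5 + 2 * k)) + 2 * L)           ≡⟨ cong (λ d → S + c′ + (3 * d + 2 * L)) (sym eD) ⟩
  S + c′ + (3 * D′ + 2 * L)                              ∎)
  where
  open ≡-Reasoning
  regroup : ∀ a d → m * (13 + 6 * k) + a + c + (3 * d + 2 * L) ≡ m * (13 + 6 * k) + (a + 3 * d) + (2 * L + c)
  regroup a d = solve (m ∷ k ∷ a ∷ c ∷ d ∷ L ∷ [])
  collect : m * (13 + 6 * k) + (2 * (L + m) + c′) + (S + 3 * D) ≡ S + c′ + (3 * (D + m * (5 + 2 * k)) + 2 * L)
  collect = solve (m ∷ k ∷ L ∷ c′ ∷ S ∷ D ∷ [])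

2*level+6≡slack+3*[2+defect] : ∀ v → 2 * level v + 6 ≡ slack v + 3 * (2 + defect v)
2*level+6≡slack+3*[2+defect] (x , y , z) =
  2 * (x + 3 * y + 3 * z) + 6 ≡ 2 * x + 3 * z + 3 * (2 + (2 * y + z)) ∋ solve (x ∷ y ∷ z ∷ [])

slack-carry : ∀ k v v′ m → level v′ ≡ level v + m → defect v′ ≡ defect v + m * N k →
              m * (13 + 6 * k) + slack v′ ≡ slack v
slack-carry k v v′ m eL eD =
  +-cancelʳ-≡ 0 _ _ (carry-slack k m (2*level+0≡slack+3*defect v) (2*level+0≡slack+3*defect v′) eL eD)
  where
  2*level+0≡slack+3*defect : ∀ v → 2 * level v + 0 ≡ slack v + 3 * defect v
  2*level+0≡slack+3*defect (x , y , z) =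
    2 * (x + 3 * y + 3 * z) + 0 ≡ 2 * x + 3 * z + 3 * (2 * y + z) ∋ solve (x ∷ y ∷ z ∷ [])

-- Factorizations of a reduced triple

-- Trade and Swap come from 3·n + (3n − 2) = 2·(3n − 1), applied t times, and from
-- (5 + 3k)·n + (3n − 1) = (3 + k)·(3n − 2).
Trade : ℕ³ → ℕ³ → Set
Trade (x , y , z) (x′ , y′ , z′) = ∃ λ t → x ≡ x′ + 3 * t × y ≡ y′ + t × z′ ≡ z + 2 * t

Swap : ℕ → ℕ³ → ℕ³ → Set
Swap k (x , y , z) (x′ , y′ , z′) = z ≡ 1 × x ≡ x′ + (5 + 3 * k) × y′ ≡ y + (3 + k) × z′ ≡ 0

valₖ-trade : ∀ k x y z t → valₖ k (x + 3 * t , y + t , z) ≡ valₖ k (x , y , z + 2 * t)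
valₖ-trade k x y z t =
  (x + 3 * t) * (5 + 2 * k) + (y + t) * (13 + 6 * k) + z * (14 + 6 * k) ≡
  x * (5 + 2 * k) + y * (13 + 6 * k) + (z + 2 * t) * (14 + 6 * k) ∋ solve (k ∷ x ∷ y ∷ z ∷ t ∷ [])

valₖ-swap : ∀ k x y z → valₖ k (x + (5 + 3 * k) , y , suc z) ≡ valₖ k (x , y + (3 + k) , z)
valₖ-swap k x y z =
  (x + (5 + 3 * k)) * (5 + 2 * k) + y * (13 + 6 * k) + suc z * (14 + 6 * k) ≡
  x * (5 + 2 * k) + (y + (3 + k)) * (13 + 6 * k) + z * (14 + 6 * k) ∋ solve (k ∷ x ∷ y ∷ z ∷ [])

Reduced : ℕ → ℕ³ → Set
Reduced k (x , y , z) = z ≤ 1 × x ≤ 6 + 3 * k × 2 * y + z < N k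

equal-carry⇒trade : ∀ {x y z x′ y′ z′} → z ≤ 1 →
  2 * y′ + z′ ≡ 2 * y + z → 2 * x′ + 3 * z′ ≡ 2 * x + 3 * z → Trade (x , y , z) (x′ , y′ , z′)
equal-carry⇒trade {x} {y} {z} {x′} {y′} {z′} z≤1 eD eS with ≤-<-connex y′ y
... | inj₂ y<y′ with m≤n⇒∃[o]m+o≡n y<y′
...   | d , refl = ⊥-elim (<⇒≱ (s≤s z≤1) (subst (2 ≤_) 2+2d+z′≡z (m≤m+n 2 _)))
  where
  2+2d+z′≡z : 2 + 2 * d + z′ ≡ z
  2+2d+z′≡z = +-cancelˡ-≡ (2 * y) _ _ (trans
    (2 * y + (2 + 2 * d + z′) ≡ 2 * (suc y + d) + z′ ∋ solve (y ∷ d ∷ z′ ∷ [])) eD)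
equal-carry⇒trade {x} {y} {z} {x′} {y′} {z′} z≤1 eD eS | inj₁ y′≤y with m≤n⇒∃[o]m+o≡n y′≤y
... | t , refl = t , x≡x′+3t , refl , z′≡z+2t
  where
  z′≡z+2t : z′ ≡ z + 2 * t
  z′≡z+2t = +-cancelˡ-≡ (2 * y′) _ _ (trans eD
    (2 * (y′ + t) + z ≡ 2 * y′ + (z + 2 * t) ∋ solve (y′ ∷ t ∷ z ∷ [])))
  x≡x′+3t : x ≡ x′ + 3 * t
  x≡x′+3t = *-cancelˡ-≡ x (x′ + 3 * t) 2 (+-cancelʳ-≡ (3 * z) _ _ (begin
    2 * x + 3 * z               ≡⟨ sym eS ⟩
    2 * x′ + 3 * z′             ≡⟨ cong (λ c → 2 * x′ + 3 * c) z′≡z+2t ⟩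
    2 * x′ + 3 * (z + 2 * t)    ≡⟨ solve (x′ ∷ z ∷ t ∷ []) ⟩
    2 * (x′ + 3 * t) + 3 * z    ∎))
    where open ≡-Reasoning

carry-one⇒swap : ∀ k {x y z x′ y′ z′} → z ≤ 1 → x ≤ 6 + 3 * k →
  2 * y′ + z′ ≡ 2 * y + z + N k → 13 + 6 * k + (2 * x′ + 3 * z′) ≡ 2 * x + 3 * z →
  Swap k (x , y , z) (x′ , y′ , z′)
carry-one⇒swap k {x} {y} {z} {x′} {y′} {z′} z≤1 x≤ eD eS with m≤n⇒∃[o]m+o≡n x≤
carry-one⇒swap k {x} {y} {0} {x′} {y′} {z′} z≤1 x≤ eD eS | ex , x+ex≡ =
  ⊥-elim (≡+suc⇒≢ (2 * x′ + 3 * z′ + 2 * ex) excess (begin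
    13 + 6 * k + (2 * x′ + 3 * z′) + 2 * ex   ≡⟨ cong (_+ 2 * ex) eS ⟩
    2 * x + 0 + 2 * ex                        ≡⟨ solve (x ∷ ex ∷ []) ⟩
    2 * (x + ex)                              ≡⟨ cong (2 *_) x+ex≡ ⟩
    2 * (6 + 3 * k)                           ≡⟨ solve (k ∷ []) ⟩
    12 + 6 * k                                ∎))
  where
  open ≡-Reasoning
  excess : 13 + 6 * k + (2 * x′ + 3 * z′) + 2 * ex ≡ 12 + 6 * k + suc (2 * x′ + 3 * z′ + 2 * ex)
  excess = solve (k ∷ x′ ∷ z′ ∷ ex ∷ [])
carry-one⇒swap k {x} {y} {1} {x′} {y′} {suc c} z≤1 x≤ eD eS | ex , x+ex≡ =
  ⊥-elim (≡+suc⇒≢ (2 * x′ + 3 * c + 2 * ex) excess (begin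
    13 + 6 * k + (2 * x′ + 3 * suc c) + 2 * ex   ≡⟨ cong (_+ 2 * ex) eS ⟩
    2 * x + 3 * 1 + 2 * ex                       ≡⟨ solve (x ∷ ex ∷ []) ⟩
    2 * (x + ex) + 3                             ≡⟨ cong (λ a → 2 * a + 3) x+ex≡ ⟩
    2 * (6 + 3 * k) + 3                          ≡⟨ solve (k ∷ []) ⟩
    15 + 6 * k                                   ∎))
  where
  open ≡-Reasoning
  excess : 13 + 6 * k + (2 * x′ + 3 * suc c) + 2 * ex ≡ 15 + 6 * k + suc (2 * x′ + 3 * c + 2 * ex)
  excess = solve (k ∷ x′ ∷ c ∷ ex ∷ [])
carry-one⇒swap k {z = suc (suc _)} (s≤s ()) x≤ eD eS | _
carry-one⇒swap k {x} {y} {1} {x′} {y′} {0} z≤1 x≤ eD eS | _ =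
  refl , x≡x′+5+3k , y′≡y+3+k , refl
  where
  open ≡-Reasoning
  x≡x′+5+3k : x ≡ x′ + (5 + 3 * k)
  x≡x′+5+3k = *-cancelˡ-≡ x _ 2 (+-cancelʳ-≡ 3 _ _ (begin
    2 * x + 3                       ≡⟨ solve (x ∷ []) ⟩
    2 * x + 3 * 1                   ≡⟨ sym eS ⟩
    13 + 6 * k + (2 * x′ + 3 * 0)   ≡⟨ solve (k ∷ x′ ∷ []) ⟩
    2 * (x′ + (5 + 3 * k)) + 3      ∎))
  y′≡y+3+k : y′ ≡ y + (3 + k)
  y′≡y+3+k = *-cancelˡ-≡ y′ _ 2 (begin
    2 * y′                      ≡⟨ sym (+-identityʳ (2 * y′)) ⟩
    2 * y′ + 0                  ≡⟨ eD ⟩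
    2 * y + 1 + (5 + 2 * k)     ≡⟨ solve (y ∷ k ∷ []) ⟩
    2 * (y + (3 + k))           ∎)

slack≤15+6k : ∀ k {x z} → z ≤ 1 → x ≤ 6 + 3 * k → 2 * x + 3 * z ≤ 15 + 6 * k
slack≤15+6k k {x} {z} z≤1 x≤ = subst (2 * x + 3 * z ≤_) (2 * (6 + 3 * k) + 3 * 1 ≡ 15 + 6 * k ∋ solve (k ∷ []))
  (+-mono-≤ (*-monoʳ-≤ 2 x≤) (*-monoʳ-≤ 3 z≤1))

carry≥2-impossible : ∀ k m {a b} → b ≤ 15 + 6 * k → (2 + m) * (13 + 6 * k) + a ≢ b
carry≥2-impossible k m {a} {b} b≤ eq with m≤n⇒∃[o]m+o≡n b≤
... | e , b+e≡ = ≡+suc⇒≢ (10 + 6 * k + m * (13 + 6 * k) + a + e) excess (trans (cong (_+ e) eq) b+e≡)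
  where
  excess : (2 + m) * (13 + 6 * k) + a + e ≡ 15 + 6 * k + suc (10 + 6 * k + m * (13 + 6 * k) + a + e)
  excess = solve (m ∷ k ∷ a ∷ e ∷ [])

classify : ∀ k v v′ → Reduced k v → valₖ k v′ ≡ valₖ k v → Trade v v′ ⊎ Swap k v v′
classify k v@(x , y , z) v′@(x′ , y′ , z′) (z≤1 , x≤ , d<N) eq with valₖ≡⇒carry k {v} {v′} eq d<N
... | 0 , eL , eD =
  inj₁ (equal-carry⇒trade {x} {y} {z} {x′} {y′} {z′} z≤1 (trans eD (+-identityʳ _)) (slack-carry k v v′ 0 eL eD))
... | 1 , eL , eD = inj₂ (carry-one⇒swap k {x} {y} {z} {x′} {y′} {z′} z≤1 x≤
  (trans eD (cong (2 * y + z +_) (*-identityˡ (N k))))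
  (trans (cong (_+ slack v′) (sym (*-identityˡ (13 + 6 * k)))) (slack-carry k v v′ 1 eL eD)))
... | suc (suc m) , eL , eD =
  ⊥-elim (carry≥2-impossible k m (slack≤15+6k k z≤1 x≤) (slack-carry k v v′ (2 + m) eL eD))

-- The Frobenius number

F₀ : ℕ → ℕ
F₀ k = (4 + 3 * k) * N k + 2

slack+carry≢1 : ∀ k x z m → 2 * x + 3 * z + m * (13 + 6 * k) ≢ 1
slack+carry≢1 k x z (suc m) = ≡+suc⇒≢ (2 * x + 3 * z + m * (13 + 6 * k) + 11 + 6 * k)
  (2 * x + 3 * z + suc m * (13 + 6 * k) ≡ 1 + suc (2 * x + 3 * z + m * (13 + 6 * k) + 11 + 6 * k)
   ∋ solve (x ∷ z ∷ m ∷ k ∷ []))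
slack+carry≢1 k (suc x) z 0 = ≡+suc⇒≢ (2 * x + 3 * z)
  (2 * suc x + 3 * z + 0 * (13 + 6 * k) ≡ 1 + suc (2 * x + 3 * z) ∋ solve (x ∷ z ∷ k ∷ []))
slack+carry≢1 k 0 (suc z) 0 = ≡+suc⇒≢ (1 + 3 * z)
  (2 * 0 + 3 * suc z + 0 * (13 + 6 * k) ≡ 1 + suc (1 + 3 * z) ∋ solve (z ∷ k ∷ []))
slack+carry≢1 k 0 0 0 ()

F₀∉T : ∀ k → ¬ InT (N k) (F₀ k)
F₀∉T k (v@(x , y , z) , eq) with carry (N k) {4 + 3 * k} {0} {level v} {2 + defect v} F₀+defect≡ (s≤s z≤n)
  where
  F₀+defect≡ : (4 + 3 * k) * N k + (2 + defect v) ≡ level v * N k + 0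
  F₀+defect≡ = begin
    (4 + 3 * k) * N k + (2 + defect v)   ≡⟨ sym (+-assoc ((4 + 3 * k) * N k) 2 (defect v)) ⟩
    F₀ k + defect v                      ≡⟨ cong (_+ defect v) (trans (sym eq) (val≡valₖ k v)) ⟩
    valₖ k v + defect v                  ≡⟨ valₖ+defect≡level*N k v ⟩
    level v * N k                        ≡⟨ sym (+-identityʳ _) ⟩
    level v * N k + 0                    ∎
    where open ≡-Reasoning
... | 0 , _ , ()
... | suc m , eL , eD = slack+carry≢1 k x z m (+-cancelˡ-≡ (13 + 6 * k) _ _ (begin
  13 + 6 * k + (slack v + m * (13 + 6 * k))    ≡⟨ regroup (slack v) ⟩
  suc m * (13 + 6 * k) + slack v + 0
    ≡⟨ carry-slack k (suc m) {4 + 3 * k} {0} {8 + 6 * k} F₀-identity (2*level+6≡slack+3*[2+defect] v) eL eD ⟩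
  8 + 6 * k + 6                                ≡⟨ solve (k ∷ []) ⟩
  13 + 6 * k + 1                               ∎))
  where
  open ≡-Reasoning
  regroup : ∀ a → 13 + 6 * k + (a + m * (13 + 6 * k)) ≡ suc m * (13 + 6 * k) + a + 0
  regroup a = solve (k ∷ a ∷ m ∷ [])
  F₀-identity : 2 * (4 + 3 * k) + 0 ≡ 8 + 6 * k + 3 * 0
  F₀-identity = solve (k ∷ [])

∈T-by-level : ∀ k {s} v → s + defect v ≡ level v * N k → InT (N k) s
∈T-by-level k v eq = v , trans (val≡valₖ k v)
  (+-cancelʳ-≡ (defect v) _ _ (trans (valₖ+defect≡level*N k v) (sym eq)))

∈T-+multiple : ∀ n {s} q → InT n s → InT n (s + q * n)
∈T-+multiple n q ((x , y , z) , eq) =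
  (x + q , y , z) , trans (shift x y z (3 * n ∸ 2) (3 * n ∸ 1)) (cong (_+ q * n) eq)
  where
  shift : ∀ x y z b c → (x + q) * n + y * b + z * c ≡ x * n + y * b + z * c + q * n
  shift x y z b c = solve (x ∷ y ∷ z ∷ b ∷ c ∷ q ∷ n ∷ [])

level-5+3k-reachable : ∀ k y z → z ≤ 1 → 2 * y + z ≤ 2 + 2 * k → ∃ λ x → level (x , y , z) ≡ 5 + 3 * k
level-5+3k-reachable k y z z≤1 d≤ with m≤n⇒∃[o]m+o≡n 3y+3z≤5+3k
  where
  3y+3z≤5+3k : 3 * y + 3 * z ≤ 5 + 3 * k
  3y+3z≤5+3k = *-cancelˡ-≤ 2 (begin
    2 * (3 * y + 3 * z)             ≡⟨ solve (y ∷ z ∷ []) ⟩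
    3 * (2 * y + z) + 3 * z         ≤⟨ +-mono-≤ (*-monoʳ-≤ 3 d≤) (*-monoʳ-≤ 3 z≤1) ⟩
    3 * (2 + 2 * k) + 3 * 1         ≤⟨ n≤1+n _ ⟩
    suc (3 * (2 + 2 * k) + 3 * 1)   ≡⟨ solve (k ∷ []) ⟩
    2 * (5 + 3 * k)                 ∎)
    where open ≤-Reasoning
... | x , 3y+3z+x≡ = x , trans (x + 3 * y + 3 * z ≡ 3 * y + 3 * z + x ∋ solve (x ∷ y ∷ z ∷ [])) 3y+3z+x≡

-- Residues r ≤ 2 + 2k are reached at level 5 + 3k, the remaining two at level 6 + 3k.
F₀+1+residue∈T : ∀ k r → r < N k → InT (N k) (suc (F₀ k) + r)
F₀+1+residue∈T k r r<N with r ≤? 2 + 2 * k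
... | yes r≤ with m≤n⇒∃[o]m+o≡n r≤
...   | t , r+t≡ with level-5+3k-reachable k (t / 2) (t % 2) (s≤s⁻¹ (m%n<n t 2))
                      (subst (_≤ 2 + 2 * k) (sym (2*[m/2]+m%2≡m t)) (subst (t ≤_) r+t≡ (m≤n+m t r)))
...     | x , level≡ = ∈T-by-level k (x , t / 2 , t % 2) (begin
  suc (F₀ k) + r + (2 * (t / 2) + t % 2)   ≡⟨ cong (suc (F₀ k) + r +_) (2*[m/2]+m%2≡m t) ⟩
  suc (F₀ k) + r + t                       ≡⟨ +-assoc (suc (F₀ k)) r t ⟩
  suc (F₀ k) + (r + t)                     ≡⟨ cong (suc (F₀ k) +_) r+t≡ ⟩
  suc (F₀ k) + (2 + 2 * k)
    ≡⟨ suc ((4 + 3 * k) * (5 + 2 * k) + 2) + (2 + 2 * k) ≡ (5 + 3 * k) * (5 + 2 * k) ∋ solve (k ∷ []) ⟩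
  (5 + 3 * k) * N k                        ≡⟨ cong (_* N k) (sym level≡) ⟩
  level (x , t / 2 , t % 2) * N k          ∎)
  where open ≡-Reasoning
F₀+1+residue∈T k r r<N | no r≰ with m≤n⇒∃[o]m+o≡n (≰⇒> r≰)
... | 0 , refl = ∈T-by-level k (0 , 2 + k , 0)
  (suc ((4 + 3 * k) * (5 + 2 * k) + 2) + (suc (2 + 2 * k) + 0) + (2 * (2 + k) + 0) ≡
   (0 + 3 * (2 + k) + 3 * 0) * (5 + 2 * k) ∋ solve (k ∷ []))
... | 1 , refl = ∈T-by-level k (0 , 1 + k , 1)
  (suc ((4 + 3 * k) * (5 + 2 * k) + 2) + (suc (2 + 2 * k) + 1) + (2 * (1 + k) + 1) ≡
   (0 + 3 * (1 + k) + 3 * 1) * (5 + 2 * k) ∋ solve (k ∷ []))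
... | suc (suc d) , refl = ⊥-elim (<⇒≱ r<N (subst (N k ≤_) N+d≡r (m≤m+n (N k) d)))
  where
  N+d≡r : 5 + 2 * k + d ≡ suc (2 + 2 * k) + suc (suc d)
  N+d≡r = solve (k ∷ d ∷ [])

F₀<m⇒∈T : ∀ k d → InT (N k) (suc (F₀ k) + d)
F₀<m⇒∈T k d = subst (InT (N k)) regroup
  (∈T-+multiple (N k) (d / N k) (F₀+1+residue∈T k (d % N k) (m%n<n d (N k))))
  where
  regroup : suc (F₀ k) + d % N k + d / N k * N k ≡ suc (F₀ k) + d
  regroup = trans (+-assoc (suc (F₀ k)) _ _) (cong (suc (F₀ k) +_) (sym (m≡m%n+[m/n]*n d (N k))))

frobenius≡F₀ : ∀ k {f} → IsFrobenius (N k) f → f ≡ F₀ k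
frobenius≡F₀ k {f} (f∉T , >f⇒∈T) with <-cmp f (F₀ k)
... | tri< f<F₀ _ _ = ⊥-elim (F₀∉T k (>f⇒∈T (F₀ k) f<F₀))
... | tri≈ _ f≡F₀ _ = f≡F₀
... | tri> _ _ F₀<f with m≤n⇒∃[o]m+o≡n F₀<f
...   | d , refl = ⊥-elim (f∉T (F₀<m⇒∈T k d))

-- The Apéry set

F₀+valₖ≡valₖ⇒levels : ∀ k v v″ → F₀ k + valₖ k v″ ≡ valₖ k v →
  level v * N k + defect v″ ≡ (4 + 3 * k + level v″) * N k + (2 + defect v)
F₀+valₖ≡valₖ⇒levels k v v″ eq = begin
    level v * N k + defect v″                      ≡⟨ cong (_+ defect v″) (sym (valₖ+defect≡level*N k v)) ⟩
    valₖ k v + defect v + defect v″                ≡⟨ cong (λ a → a + defect v + defect v″) (sym eq) ⟩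
    F₀ k + valₖ k v″ + defect v + defect v″        ≡⟨ regroup (valₖ k v″) (defect v) (defect v″) ⟩
    F₀ k + (valₖ k v″ + defect v″) + defect v      ≡⟨ cong (λ a → F₀ k + a + defect v) (valₖ+defect≡level*N k v″) ⟩
    F₀ k + level v″ * N k + defect v               ≡⟨ expand (level v″) (defect v) ⟩
    (4 + 3 * k + level v″) * N k + (2 + defect v)  ∎
    where
    open ≡-Reasoning
    regroup : ∀ a b c → F₀ k + a + b + c ≡ F₀ k + (a + c) + b
    regroup a b c = solve (k ∷ a ∷ b ∷ c ∷ [])
    expand : ∀ l d → F₀ k + l * N k + d ≡ (4 + 3 * k + l) * N k + (2 + d)
    expand l d = (4 + 3 * k) * (5 + 2 * k) + 2 + l * (5 + 2 * k) + d ≡ (4 + 3 * k + l) * (5 + 2 * k) + (2 + d)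
                 ∋ solve (k ∷ l ∷ d ∷ [])

F₀+valₖ≢valₖ : ∀ k v v″ → defect v + 2 < N k → slack v ≤ 13 + 6 * k → F₀ k + valₖ k v″ ≢ valₖ k v
F₀+valₖ≢valₖ k v v″@(x″ , y″ , z″) d<N s≤ eq =
  too-large (carry (N k) (F₀+valₖ≡valₖ⇒levels k v v″ eq) (subst (_< N k) (+-comm (defect v) 2) d<N))
            (m≤n⇒∃[o]m+o≡n s≤)
  where
  shifted-identity : 2 * (4 + 3 * k + level v″) + 0 ≡ 8 + 6 * k + slack v″ + 3 * defect v″
  shifted-identity =
    2 * (4 + 3 * k + (x″ + 3 * y″ + 3 * z″)) + 0 ≡ 8 + 6 * k + (2 * x″ + 3 * z″) + 3 * (2 * y″ + z″)
    ∋ solve (k ∷ x″ ∷ y″ ∷ z″ ∷ [])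
  too-large : (∃ λ m → 4 + 3 * k + level v″ ≡ level v + m × defect v″ ≡ 2 + defect v + m * N k) →
              (∃ λ e → slack v + e ≡ 13 + 6 * k) → ⊥
  too-large (m , eL , eD) (e , slack+e≡) =
    ≡+suc⇒≢ (m * (13 + 6 * k) + slack v″ + e) (excess (slack v″)) (begin
      m * (13 + 6 * k) + (8 + 6 * k + slack v″) + 6 + e
        ≡⟨ cong (_+ e) (carry-slack k m {level v} {2 + defect v} {slack v}
                         (2*level+6≡slack+3*[2+defect] v) shifted-identity eL eD) ⟩
      slack v + 0 + e    ≡⟨ cong (_+ e) (+-identityʳ (slack v)) ⟩
      slack v + e        ≡⟨ slack+e≡ ⟩
      13 + 6 * k         ∎)
    where
    open ≡-Reasoning
    excess : ∀ a → m * (13 + 6 * k) + (8 + 6 * k + a) + 6 + e ≡ 13 + 6 * k + suc (m * (13 + 6 * k) + a + e)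
    excess a = solve (k ∷ a ∷ m ∷ e ∷ [])

∈Ap : ∀ k v → defect v + 2 < N k → slack v ≤ 13 + 6 * k → valₖ k v ≢ F₀ k + F₀ k →
      InAp (N k) (F₀ k) (val (N k) v)
∈Ap k v d<N s≤ ≢2F₀ = inj₁ (v , refl) , s∸F₀∉S
  where
  open ≡-Reasoning
  s : ℕ
  s = val (N k) v
  s∸F₀∉S : ¬ (F₀ k ≤ s × InS (N k) (F₀ k) (s ∸ F₀ k))
  s∸F₀∉S (F₀≤s , inj₁ (v″ , e)) = F₀+valₖ≢valₖ k v v″ d<N s≤ (begin
    F₀ k + valₖ k v″           ≡⟨ cong (F₀ k +_) (trans (sym (val≡valₖ k v″)) e) ⟩
    F₀ k + (s ∸ F₀ k)          ≡⟨ m+[n∸m]≡n F₀≤s ⟩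
    s                          ≡⟨ val≡valₖ k v ⟩
    valₖ k v                   ∎)
  s∸F₀∉S (F₀≤s , inj₂ e) = ≢2F₀ (begin
    valₖ k v                   ≡⟨ sym (val≡valₖ k v) ⟩
    s                          ≡⟨ sym (m+[n∸m]≡n F₀≤s) ⟩
    F₀ k + (s ∸ F₀ k)          ≡⟨ cong (F₀ k +_) e ⟩
    F₀ k + F₀ k                ∎)

-- The only normal form with defect ≥ n; its value is F(T) + valₖ k (x + 1 , 1 , 0).
[x,2+k,1]∉Ap : ∀ k x → ¬ InAp (N k) (F₀ k) (val (N k) (x , 2 + k , 1))
[x,2+k,1]∉Ap k x (_ , ∉Ap) = ∉Ap (F₀≤s , inj₁ ((x + 1 , 1 , 0) , s∸F₀≡))
  where
  open ≡-Reasoning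
  s w : ℕ
  s = val (N k) (x , 2 + k , 1)
  w = valₖ k (x + 1 , 1 , 0)
  expand : ∀ x → (4 + 3 * k) * (5 + 2 * k) + 2 + ((x + 1) * (5 + 2 * k) + 1 * (13 + 6 * k) + 0 * (14 + 6 * k))
              ≡ x * (5 + 2 * k) + (2 + k) * (13 + 6 * k) + 1 * (14 + 6 * k)
  expand x = solve (x ∷ k ∷ [])
  s≡ : F₀ k + w ≡ s
  s≡ = trans (expand x) (sym (val≡valₖ k (x , 2 + k , 1)))
  F₀≤s : F₀ k ≤ s
  F₀≤s = subst (F₀ k ≤_) s≡ (m≤m+n (F₀ k) w)
  s∸F₀≡ : val (N k) (x + 1 , 1 , 0) ≡ s ∸ F₀ k
  s∸F₀≡ = begin
    val (N k) (x + 1 , 1 , 0)   ≡⟨ val≡valₖ k (x + 1 , 1 , 0) ⟩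
    w                           ≡⟨ sym (m+n∸m≡n (F₀ k) w) ⟩
    F₀ k + w ∸ F₀ k             ≡⟨ cong (_∸ F₀ k) s≡ ⟩
    s ∸ F₀ k                    ∎

nf∈Ap⇒reduced : ∀ k {s x y z} → IsNf (N k) s (x , y , z) → InAp (N k) (F₀ k) s → Reduced k (x , y , z)
nf∈Ap⇒reduced k {s} {x} {y} {z} (val≡s , z<2 , y< , x<) s∈Ap =
  s≤s⁻¹ z<2 , s≤s⁻¹ (subst (x <_) ([3N∸1]/2≡7+3k k) x<) ,
  defect<N (m≤n⇒m<n∨m≡n (s≤s⁻¹ (subst (y <_) ([N+1]/2≡3+k k) y<))) z<2
  where
  defect<N : y < 2 + k ⊎ y ≡ 2 + k → z < 2 → 2 * y + z < N k
  defect<N (inj₁ y<2+k) (s≤s z≤1) = begin-strict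
    2 * y + z              ≤⟨ +-mono-≤ (*-monoʳ-≤ 2 (s≤s⁻¹ y<2+k)) z≤1 ⟩
    2 * (1 + k) + 1        ≡⟨ 2 * (1 + k) + 1 ≡ 3 + 2 * k ∋ solve (k ∷ []) ⟩
    3 + 2 * k              <⟨ n<1+n _ ⟩
    4 + 2 * k              <⟨ n<1+n _ ⟩
    5 + 2 * k              ∎
    where open ≤-Reasoning
  defect<N (inj₂ refl) (s≤s z≤n) = ≤-reflexive (suc (2 * (2 + k) + 0) ≡ 5 + 2 * k ∋ solve (k ∷ []))
  defect<N (inj₂ refl) (s≤s (s≤s z≤n)) =
    ⊥-elim ([x,2+k,1]∉Ap k x (subst (InAp (N k) (F₀ k)) (sym val≡s) s∈Ap))

-- Counting factorizations

Z-≡ : ∀ {n s} {a b : Z n s} → proj₁ a ≡ proj₁ b → a ≡ b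
Z-≡ eq = Σ-≡,≡→≡ (eq , ≡-irrelevant _ _)

triple-≡ : ∀ {x y z x′ y′ z′ : ℕ} → x ≡ x′ → y ≡ y′ → z ≡ z′ → (x , y , z) ≡ (x′ , y′ , z′)
triple-≡ refl refl refl = refl

valₖ≡-from-Z : ∀ k {v} (w : Z (N k) (val (N k) v)) → valₖ k (proj₁ w) ≡ valₖ k v
valₖ≡-from-Z k {v} (w , eq) = trans (sym (val≡valₖ k w)) (trans eq (val≡valₖ k v))

module Trades (k x₀ y z : ℕ) where

  v : ℕ³
  v = (x₀ + 3 * y , y , z)

  traded-val : ∀ u → u ≤ y → val (N k) (x₀ + 3 * u , u , z + 2 * (y ∸ u)) ≡ val (N k) v
  traded-val u u≤y = begin
    val (N k) (x₀ + 3 * u , u , z + 2 * (y ∸ u))          ≡⟨ val≡valₖ k (x₀ + 3 * u , u , z + 2 * (y ∸ u)) ⟩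
    valₖ k (x₀ + 3 * u , u , z + 2 * (y ∸ u))             ≡⟨ sym (valₖ-trade k (x₀ + 3 * u) u z (y ∸ u)) ⟩
    valₖ k (x₀ + 3 * u + 3 * (y ∸ u) , u + (y ∸ u) , z)   ≡⟨ cong₂ (λ a b → valₖ k (a , b , z)) x≡ u+[y∸u]≡y ⟩
    valₖ k v                                              ≡⟨ sym (val≡valₖ k v) ⟩
    val (N k) v                                           ∎
    where
    open ≡-Reasoning
    u+[y∸u]≡y : u + (y ∸ u) ≡ y
    u+[y∸u]≡y = m+[n∸m]≡n u≤y
    x≡ : x₀ + 3 * u + 3 * (y ∸ u) ≡ x₀ + 3 * y
    x≡ = trans (+-assoc x₀ _ _) (cong (x₀ +_) (trans (sym (*-distribˡ-+ 3 u (y ∸ u))) (cong (3 *_) u+[y∸u]≡y)))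

  traded : Fin (suc y) → Z (N k) (val (N k) v)
  traded u = (x₀ + 3 * toℕ u , toℕ u , z + 2 * (y ∸ toℕ u)) , traded-val (toℕ u) (toℕ≤pred[n] u)

  trade-index< : ∀ w → Trade v w → proj₁ (proj₂ w) < suc y
  trade-index< _ (t , _ , refl , _) = s≤s (m≤m+n _ t)

  traded-onto : ∀ u (w : Z (N k) (val (N k) v)) → Trade v (proj₁ w) → toℕ u ≡ proj₁ (proj₂ (proj₁ w)) →
                traded u ≡ w
  traded-onto u ((x′ , y′ , z′) , _) (t , x≡ , refl , z′≡) u≡y′ = Z-≡ (triple-≡ x′≡ u≡y′ z≡)
    where
    open ≡-Reasoning
    x′≡ : x₀ + 3 * toℕ u ≡ x′
    x′≡ = +-cancelʳ-≡ (3 * t) _ _ (begin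
      x₀ + 3 * toℕ u + 3 * t      ≡⟨ cong (λ a → x₀ + 3 * a + 3 * t) u≡y′ ⟩
      x₀ + 3 * y′ + 3 * t         ≡⟨ +-assoc x₀ _ _ ⟩
      x₀ + (3 * y′ + 3 * t)       ≡⟨ cong (x₀ +_) (sym (*-distribˡ-+ 3 y′ t)) ⟩
      x₀ + 3 * (y′ + t)           ≡⟨ x≡ ⟩
      x′ + 3 * t                  ∎)
    z≡ : z + 2 * (y′ + t ∸ toℕ u) ≡ z′
    z≡ = begin
      z + 2 * (y′ + t ∸ toℕ u)    ≡⟨ cong (λ a → z + 2 * (y′ + t ∸ a)) u≡y′ ⟩
      z + 2 * (y′ + t ∸ y′)       ≡⟨ cong (λ a → z + 2 * a) (m+n∸m≡n y′ t) ⟩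
      z + 2 * t                   ≡⟨ sym z′≡ ⟩
      z′                          ∎

module _ (k x₀ y : ℕ) (red : Reduced k (x₀ + 3 * y , y , 0)) where
  open Trades k x₀ y 0

  private
    trade-of : ∀ w → Trade v (proj₁ w)
    trade-of w = [ id , (λ { (() , _) }) ]′ (classify k v (proj₁ w) red (valₖ≡-from-Z k {v} w))

  card-without-swap : Fin (suc y) ↔ Z (N k) (val (N k) v)
  card-without-swap = mk↔ₛ′ traded (λ w → fromℕ< (trade-index< (proj₁ w) (trade-of w)))
    (λ w → traded-onto _ w (trade-of w) (toℕ-fromℕ< _)) (λ u → fromℕ<-toℕ u _)

module _ (k x₀ y : ℕ) (red : Reduced k (x₀ + 3 * y , y , 1)) (x≡ : x₀ + 3 * y ≡ 5 + 3 * k) where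
  open Trades k x₀ y 1

  private
    swapped : Z (N k) (val (N k) v)
    swapped = (0 , y + (3 + k) , 0) , (begin
      val (N k) (0 , y + (3 + k) , 0)    ≡⟨ val≡valₖ k (0 , y + (3 + k) , 0) ⟩
      valₖ k (0 , y + (3 + k) , 0)       ≡⟨ sym (valₖ-swap k 0 y 0) ⟩
      valₖ k (5 + 3 * k , y , 1)         ≡⟨ cong (λ a → valₖ k (a , y , 1)) (sym x≡) ⟩
      valₖ k v                           ≡⟨ sym (val≡valₖ k v) ⟩
      val (N k) v                        ∎)
      where open ≡-Reasoning

    trade-of : ∀ x′ y′ c (p : val (N k) (x′ , y′ , suc c) ≡ val (N k) v) → Trade v (x′ , y′ , suc c)
    trade-of x′ y′ c p = [ id , (λ { (_ , _ , _ , ()) }) ]′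
      (classify k v (x′ , y′ , suc c) red (valₖ≡-from-Z k {v} ((x′ , y′ , suc c) , p)))

    swap-of : ∀ x′ y′ (p : val (N k) (x′ , y′ , 0) ≡ val (N k) v) → Swap k v (x′ , y′ , 0)
    swap-of x′ y′ p = [ (λ { (_ , _ , _ , ()) }) , id ]′
      (classify k v (x′ , y′ , 0) red (valₖ≡-from-Z k {v} ((x′ , y′ , 0) , p)))

    to : Fin (2 + y) → Z (N k) (val (N k) v)
    to fzero = swapped
    to (fsuc u) = traded u

    from : Z (N k) (val (N k) v) → Fin (2 + y)
    from ((x′ , y′ , zero) , p) = fzero
    from ((x′ , y′ , suc c) , p) = fsuc (fromℕ< (trade-index< (x′ , y′ , suc c) (trade-of x′ y′ c p)))

    to∘from : ∀ w → to (from w) ≡ w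
    to∘from w@((x′ , y′ , suc c) , p) = traded-onto _ w (trade-of x′ y′ c p) (toℕ-fromℕ< _)
    to∘from ((x′ , y′ , zero) , p) = swapped≡ (swap-of x′ y′ p)
      where
      swapped≡ : Swap k v (x′ , y′ , 0) → swapped ≡ ((x′ , y′ , 0) , p)
      swapped≡ (_ , x≡x′+5+3k , y′≡ , _) =
        Z-≡ (triple-≡ (+-cancelʳ-≡ (5 + 3 * k) 0 x′ (trans (sym x≡) x≡x′+5+3k)) (sym y′≡) refl)

    from∘to : ∀ u → from (to u) ≡ u
    from∘to fzero = refl
    from∘to (fsuc u) = cong fsuc (fromℕ<-toℕ u _)

  card-with-swap : Fin (2 + y) ↔ Z (N k) (val (N k) v)
  card-with-swap = mk↔ₛ′ to from to∘from from∘to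

-- Minimal normal forms

vᵢ' : ℕ → ℕ³
vᵢ' j = (3 * (1 + j) , 1 + j , 0)

vᵢ : ℕ → ℕ → ℕ³
vᵢ k j = (5 + 3 * k , j , 1)

module _ (k j : ℕ) {x y z : ℕ} (red : Reduced k (x , y , z))
         (vᵢ'≰ : ¬ vᵢ' j ≤₃ (x , y , z)) (vᵢ≰ : ¬ vᵢ k j ≤₃ (x , y , z)) where

  private
    v : ℕ³
    v = (x , y , z)

    index : ∀ w → Trade v w ⊎ Swap k v w → ℕ
    index _ (inj₁ (t , _)) = t
    index _ (inj₂ _) = j

    index<1+j : ∀ w (c : Trade v w ⊎ Swap k v w) → index w c < suc j
    index<1+j _ (inj₂ _) = n<1+n j
    index<1+j (x′ , y′ , _) (inj₁ (t , x≡ , y≡ , _)) with t ≤? j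
    ... | yes t≤j = s≤s t≤j
    ... | no t≰j = ⊥-elim (vᵢ'≰ (≤-trans (*-monoʳ-≤ 3 1+j≤t) (subst (3 * t ≤_) (sym x≡) (m≤n+m _ x′)) ,
                                 ≤-trans 1+j≤t (subst (t ≤_) (sym y≡) (m≤n+m t y′)) , z≤n))
      where
      1+j≤t : 1 + j ≤ t
      1+j≤t = ≰⇒> t≰j

    swap⇒vᵢ≤ : ∀ {w} → Swap k v w → j ≤ y → vᵢ k j ≤₃ v
    swap⇒vᵢ≤ {x′ , _ , _} (refl , x≡ , _) j≤y = subst (5 + 3 * k ≤_) (sym x≡) (m≤n+m _ x′) , j≤y , ≤-refl

    index-injective : ∀ w₁ w₂ c₁ c₂ → index w₁ c₁ ≡ index w₂ c₂ → w₁ ≡ w₂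
    index-injective (x₁ , y₁ , z₁) (x₂ , y₂ , z₂) (inj₁ (t , x≡₁ , y≡₁ , z≡₁)) (inj₁ (.t , x≡₂ , y≡₂ , z≡₂)) refl =
      triple-≡ (+-cancelʳ-≡ (3 * t) x₁ x₂ (trans (sym x≡₁) x≡₂))
               (+-cancelʳ-≡ t y₁ y₂ (trans (sym y≡₁) y≡₂)) (trans z≡₁ (sym z≡₂))
    index-injective (x₁ , _ , _) (x₂ , _ , _) (inj₂ (_ , x≡₁ , y≡₁ , z≡₁)) (inj₂ (_ , x≡₂ , y≡₂ , z≡₂)) _ =
      triple-≡ (+-cancelʳ-≡ (5 + 3 * k) x₁ x₂ (trans (sym x≡₁) x≡₂)) (trans y≡₁ (sym y≡₂)) (trans z≡₁ (sym z≡₂))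
    index-injective (_ , y₁ , _) _ (inj₁ (t , _ , y≡₁ , _)) (inj₂ sw) refl =
      ⊥-elim (vᵢ≰ (swap⇒vᵢ≤ sw (subst (t ≤_) (sym y≡₁) (m≤n+m t y₁))))
    index-injective _ (_ , y₂ , _) (inj₂ sw) (inj₁ (t , _ , y≡₂ , _)) refl =
      ⊥-elim (vᵢ≰ (swap⇒vᵢ≤ sw (subst (t ≤_) (sym y≡₂) (m≤n+m t y₂))))

  undominated⇒¬HasCard : ¬ HasCard (N k) (val (N k) (x , y , z)) (2 + j)
  undominated⇒¬HasCard card = <⇒≱ (n<1+n (suc j)) (injective⇒≤ {f = squeeze} squeeze-injective)
    where
    open Inverse card
    classes : ∀ u → Trade v (proj₁ (to u)) ⊎ Swap k v (proj₁ (to u))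
    classes u = classify k v (proj₁ (to u)) red (valₖ≡-from-Z k {v} (to u))
    squeeze : Fin (2 + j) → Fin (1 + j)
    squeeze u = fromℕ< (index<1+j (proj₁ (to u)) (classes u))
    squeeze-injective : ∀ {a b} → squeeze a ≡ squeeze b → a ≡ b
    squeeze-injective {a} {b} eq = begin
      a               ≡⟨ sym (strictlyInverseʳ a) ⟩
      from (to a)     ≡⟨ cong from (Z-≡ (index-injective _ _ (classes a) (classes b) indices≡)) ⟩
      from (to b)     ≡⟨ strictlyInverseʳ b ⟩
      b               ∎
      where
      open ≡-Reasoning
      indices≡ : index (proj₁ (to a)) (classes a) ≡ index (proj₁ (to b)) (classes b)
      indices≡ = trans (sym (toℕ-fromℕ< _)) (trans (cong toℕ eq) (toℕ-fromℕ< _))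

_≤₃?_ : ∀ v w → Dec (v ≤₃ w)
(x , y , z) ≤₃? (x′ , y′ , z′) = x ≤? x′ ×-dec y ≤? y′ ×-dec z ≤? z′

≤₃-trans : ∀ {u v w} → u ≤₃ v → v ≤₃ w → u ≤₃ w
≤₃-trans (a , b , c) (a′ , b′ , c′) = ≤-trans a a′ , ≤-trans b b′ , ≤-trans c c′

≤₃-antisym : ∀ {v w} → v ≤₃ w → w ≤₃ v → v ≡ w
≤₃-antisym (a , b , c) (a′ , b′ , c′) = triple-≡ (≤-antisym a a′) (≤-antisym b b′) (≤-antisym c c′)

Minimal : (ℕ³ → Set) → ℕ³ → Set
Minimal X v = ∀ w → X w → w ≤₃ v → w ≡ v

module TwoCones (X : ℕ³ → Set) {a b : ℕ³} (b≰a : ¬ b ≤₃ a) (a≰b : ¬ a ≤₃ b)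
         (cover : ∀ {w} → X w → a ≤₃ w ⊎ b ≤₃ w) where

  minimalˡ : Minimal X a
  minimalˡ w Xw w≤a with cover Xw
  ... | inj₁ a≤w = ≤₃-antisym w≤a a≤w
  ... | inj₂ b≤w = ⊥-elim (b≰a (≤₃-trans b≤w w≤a))

  minimalʳ : Minimal X b
  minimalʳ w Xw w≤b with cover Xw
  ... | inj₁ a≤w = ⊥-elim (a≰b (≤₃-trans a≤w w≤b))
  ... | inj₂ b≤w = ≤₃-antisym w≤b b≤w

  minimal⇒≡⊎≡ : ∀ {v} → X a → X b → X v → Minimal X v → v ≡ a ⊎ v ≡ b
  minimal⇒≡⊎≡ Xa Xb Xv min with cover Xv
  ... | inj₁ a≤v = inj₁ (sym (min a Xa a≤v))
  ... | inj₂ b≤v = inj₂ (sym (min b Xb b≤v))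

nf-dominates : ∀ k j {s x y z} → IsNf (N k) s (x , y , z) → InM (N k) (F₀ k) (2 + j) s →
               vᵢ' j ≤₃ (x , y , z) ⊎ vᵢ k j ≤₃ (x , y , z)
nf-dominates k j {s} {x} {y} {z} nf@(val≡s , _) (s∈Ap , card) with vᵢ' j ≤₃? (x , y , z) | vᵢ k j ≤₃? (x , y , z)
... | yes vᵢ'≤ | _        = inj₁ vᵢ'≤
... | no _     | yes vᵢ≤  = inj₂ vᵢ≤
... | no vᵢ'≰  | no vᵢ≰   = ⊥-elim (undominated⇒¬HasCard k j (nf∈Ap⇒reduced k nf s∈Ap) vᵢ'≰ vᵢ≰
                              (subst (λ s → HasCard (N k) s (2 + j)) (sym val≡s) card))

sᵢ≡val : ∀ k j → sᵢ (N k) (2 + j) ≡ val (N k) (vᵢ k j)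
sᵢ≡val k j = cong₂ (λ a c → a * N k + j * (3 * N k ∸ 2) + c) ([3N∸5]/2≡5+3k k) (sym (*-identityˡ (3 * N k ∸ 1)))

sᵢ'≡val : ∀ k j → sᵢ' (N k) (2 + j) ≡ val (N k) (vᵢ' j)
sᵢ'≡val k j = sym (+-identityʳ _)

-- Writing k = j + e turns every bound needed below into a ring identity.
module Candidates (j e : ℕ) where

  k : ℕ
  k = j + e

  sᵢ≢sᵢ' : sᵢ (N k) (2 + j) ≢ sᵢ' (N k) (2 + j)
  sᵢ≢sᵢ' eq = ≡+suc⇒≢ (6 * j * e + 6 * e * e + 4 * j + 19 * e + 10) excess (begin
    valₖ k (vᵢ k j)            ≡⟨ sym (val≡valₖ k (vᵢ k j)) ⟩
    val (N k) (vᵢ k j)         ≡⟨ sym (sᵢ≡val k j) ⟩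
    sᵢ (N k) (2 + j)           ≡⟨ eq ⟩
    sᵢ' (N k) (2 + j)          ≡⟨ sᵢ'≡val k j ⟩
    val (N k) (vᵢ' j)          ≡⟨ val≡valₖ k (vᵢ' j) ⟩
    valₖ k (vᵢ' j)             ∎)
    where
    open ≡-Reasoning
    excess : valₖ k (vᵢ k j) ≡ valₖ k (vᵢ' j) + suc (6 * j * e + 6 * e * e + 4 * j + 19 * e + 10)
    excess = (5 + 3 * (j + e)) * (5 + 2 * (j + e)) + j * (13 + 6 * (j + e)) + 1 * (14 + 6 * (j + e)) ≡
             3 * (1 + j) * (5 + 2 * (j + e)) + (1 + j) * (13 + 6 * (j + e)) + 0 * (14 + 6 * (j + e)) +
               suc (6 * j * e + 6 * e * e + 4 * j + 19 * e + 10) ∋ solve (j ∷ e ∷ [])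

  vᵢ'-reduced : Reduced k (vᵢ' j)
  vᵢ'-reduced = z≤n ,
    +≡⇒≤ (3 + 3 * e) (3 * (1 + j) + (3 + 3 * e) ≡ 6 + 3 * (j + e) ∋ solve (j ∷ e ∷ [])) ,
    +≡⇒≤ (2 + 2 * e) (suc (2 * (1 + j) + 0) + (2 + 2 * e) ≡ 5 + 2 * (j + e) ∋ solve (j ∷ e ∷ []))

  vᵢ'∈M : InM (N k) (F₀ k) (2 + j) (val (N k) (vᵢ' j))
  vᵢ'∈M = ∈Ap k (vᵢ' j)
            (+≡⇒≤ (2 * e) (suc (2 * (1 + j) + 0 + 2) + 2 * e ≡ 5 + 2 * (j + e) ∋ solve (j ∷ e ∷ [])))
            (+≡⇒≤ (7 + 6 * e) (2 * (3 * (1 + j)) + 3 * 0 + (7 + 6 * e) ≡ 13 + 6 * (j + e) ∋ solve (j ∷ e ∷ [])))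
            (λ h → ≡+suc⇒≢ (12 * j * e + 12 * e * e + 6 * j + 34 * e + 15) excess (sym h)) ,
          card-without-swap k 0 (1 + j) vᵢ'-reduced
    where
    excess : F₀ k + F₀ k ≡ valₖ k (vᵢ' j) + suc (12 * j * e + 12 * e * e + 6 * j + 34 * e + 15)
    excess = (4 + 3 * (j + e)) * (5 + 2 * (j + e)) + 2 + ((4 + 3 * (j + e)) * (5 + 2 * (j + e)) + 2) ≡
             3 * (1 + j) * (5 + 2 * (j + e)) + (1 + j) * (13 + 6 * (j + e)) + 0 * (14 + 6 * (j + e)) +
               suc (12 * j * e + 12 * e * e + 6 * j + 34 * e + 15) ∋ solve (j ∷ e ∷ [])

  vᵢ∈M : InM (N k) (F₀ k) (2 + j) (val (N k) (vᵢ k j))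
  vᵢ∈M = ∈Ap k (vᵢ k j)
           (+≡⇒≤ (1 + 2 * e) (suc (2 * j + 1 + 2) + (1 + 2 * e) ≡ 5 + 2 * (j + e) ∋ solve (j ∷ e ∷ [])))
           (≤-reflexive (2 * (5 + 3 * (j + e)) + 3 * 1 ≡ 13 + 6 * (j + e) ∋ solve (j ∷ e ∷ [])))
           (λ h → ≡+suc⇒≢ (6 * j * e + 6 * e * e + 2 * j + 15 * e + 4) excess (sym h)) ,
         subst (λ x → HasCard (N k) (val (N k) (x , j , 1)) (2 + j)) x≡
           (card-with-swap k (5 + 3 * e) j
              (s≤s z≤n ,
               +≡⇒≤ 1 (5 + 3 * e + 3 * j + 1 ≡ 6 + 3 * (j + e) ∋ solve (j ∷ e ∷ [])) ,
               +≡⇒≤ (3 + 2 * e) (suc (2 * j + 1) + (3 + 2 * e) ≡ 5 + 2 * (j + e) ∋ solve (j ∷ e ∷ []))) x≡)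
    where
    x≡ : 5 + 3 * e + 3 * j ≡ 5 + 3 * (j + e)
    x≡ = solve (e ∷ j ∷ [])
    excess : F₀ k + F₀ k ≡ valₖ k (vᵢ k j) + suc (6 * j * e + 6 * e * e + 2 * j + 15 * e + 4)
    excess = (4 + 3 * (j + e)) * (5 + 2 * (j + e)) + 2 + ((4 + 3 * (j + e)) * (5 + 2 * (j + e)) + 2) ≡
             (5 + 3 * (j + e)) * (5 + 2 * (j + e)) + j * (13 + 6 * (j + e)) + 1 * (14 + 6 * (j + e)) +
               suc (6 * j * e + 6 * e * e + 2 * j + 15 * e + 4) ∋ solve (j ∷ e ∷ [])

  vᵢ'-nf : IsNf (N k) (val (N k) (vᵢ' j)) (vᵢ' j)
  vᵢ'-nf = refl , s≤s z≤n ,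
    subst (1 + j <_) (sym ([N+1]/2≡3+k k))
      (+≡⇒≤ (1 + e) (suc (1 + j) + (1 + e) ≡ 3 + (j + e) ∋ solve (j ∷ e ∷ []))) ,
    subst (3 * (1 + j) <_) (sym ([3N∸1]/2≡7+3k k))
      (+≡⇒≤ (3 + 3 * e) (suc (3 * (1 + j)) + (3 + 3 * e) ≡ 7 + 3 * (j + e) ∋ solve (j ∷ e ∷ [])))

  vᵢ-nf : IsNf (N k) (val (N k) (vᵢ k j)) (vᵢ k j)
  vᵢ-nf = refl , s≤s (s≤s z≤n) ,
    subst (j <_) (sym ([N+1]/2≡3+k k)) (+≡⇒≤ (2 + e) (suc j + (2 + e) ≡ 3 + (j + e) ∋ solve (j ∷ e ∷ []))) ,
    subst (5 + 3 * k <_) (sym ([3N∸1]/2≡7+3k k)) (n≤1+n (6 + 3 * k))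

  NfOfMᵢ : ℕ³ → Set
  NfOfMᵢ w = ∃ λ s → InM (N k) (F₀ k) (2 + j) s × IsNf (N k) s w

  vᵢ≰vᵢ' : ¬ vᵢ k j ≤₃ vᵢ' j
  vᵢ≰vᵢ' (_ , _ , ())

  vᵢ'≰vᵢ : ¬ vᵢ' j ≤₃ vᵢ k j
  vᵢ'≰vᵢ (_ , 1+j≤j , _) = 1+n≰n 1+j≤j

  NfOfMᵢ-covered : ∀ {w} → NfOfMᵢ w → vᵢ' j ≤₃ w ⊎ vᵢ k j ≤₃ w
  NfOfMᵢ-covered {x , y , z} (_ , s∈M , nf) = nf-dominates k j nf s∈M

  calMᵢ⇔ : ∀ s → InCalM (N k) (F₀ k) (2 + j) s ⇔ (s ≡ sᵢ (N k) (2 + j) ⊎ s ≡ sᵢ' (N k) (2 + j))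
  calMᵢ⇔ s = mk⇔ forward backward
    where
    open TwoCones NfOfMᵢ vᵢ≰vᵢ' vᵢ'≰vᵢ NfOfMᵢ-covered
    forward : InCalM (N k) (F₀ k) (2 + j) s → s ≡ sᵢ (N k) (2 + j) ⊎ s ≡ sᵢ' (N k) (2 + j)
    forward (s∈M , v , nf@(val≡s , _) , minimal) =
      [ (λ v≡vᵢ' → inj₂ (s≡ v≡vᵢ' (sᵢ'≡val k j))) , (λ v≡vᵢ → inj₁ (s≡ v≡vᵢ (sᵢ≡val k j))) ]′
        (minimal⇒≡⊎≡ (_ , vᵢ'∈M , vᵢ'-nf) (_ , vᵢ∈M , vᵢ-nf) (s , s∈M , nf)
          (λ w (s′ , s′∈M , nf′) → minimal s′ w s′∈M nf′))
      where
      s≡ : ∀ {u t} → v ≡ u → t ≡ val (N k) u → s ≡ t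
      s≡ v≡u t≡ = trans (sym val≡s) (trans (cong (val (N k)) v≡u) (sym t≡))
    backward : s ≡ sᵢ (N k) (2 + j) ⊎ s ≡ sᵢ' (N k) (2 + j) → InCalM (N k) (F₀ k) (2 + j) s
    backward (inj₁ refl) = subst (InCalM (N k) (F₀ k) (2 + j)) (sym (sᵢ≡val k j))
      (vᵢ∈M , vᵢ k j , vᵢ-nf ,
       λ s′ w s′∈M nf′ → minimalʳ w (s′ , s′∈M , nf′))
    backward (inj₂ refl) = subst (InCalM (N k) (F₀ k) (2 + j)) (sym (sᵢ'≡val k j))
      (vᵢ'∈M , vᵢ' j , vᵢ'-nf ,
       λ s′ w s′∈M nf′ → minimalˡ w (s′ , s′∈M , nf′))

mainTheorem11 : (n f i : ℕ) → 5 ≤ n → n % 2 ≡ 1 → IsFrobenius n f →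
    2 ≤ i → i ≤ (n ∸ 1) / 2 →
    sᵢ n i ≢ sᵢ' n i ×
    (∀ s → InCalM n f i s ⇔ (s ≡ sᵢ n i ⊎ s ≡ sᵢ' n i))
mainTheorem11 n f i 5≤n odd frob 2≤i i≤ with odd≥5⇒≡N n 5≤n odd
... | k , refl with m≤n⇒∃[o]m+o≡n 2≤i
...   | j , refl with m≤n⇒∃[o]m+o≡n (+-cancelˡ-≤ 2 j k (subst (2 + j ≤_) ([N∸1]/2≡2+k k) i≤))
...     | e , refl rewrite frobenius≡F₀ (j + e) frob = Candidates.sᵢ≢sᵢ' j e , Candidates.calMᵢ⇔ j e
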